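{- Let $A$ be a commutative algebra over the field $\mathbb{Q}((q))$ of formal Laurent series, let $F(t)\in A[[t]]$ with $F(0)=0$, and let $\psi=q^m$ with $m\in\mathbb{Z}\setminus\{0\}$. Then: (i) for all $k\ge0$, $F^{[k]^*_{\psi}}=F^{[k]_{\psi^{ -1}}}$; (ii) for every $G(t)\in A[[t]]$, $G[F]^*_{\psi}=G[F]_{\psi^{ -1}}$; (iii) $\mathbf{E}_{\psi}[F]^*_{\psi}=\mathbf{e}_{\psi^{ -1}}[F]_{\psi^{ -1}}$; in particular, $\mathbf{E}_q[F]^*_q=\mathbf{e}_{q^{ -1}}[F]_{q^{ -1}}$.
   Context: For $\phi\in\{\psi,\psi^{ -1}\}$: $[n]_\phi=1+\phi+\cdots+\phi^{n-1}$ for $n\ge1$, $[0]_\phi=0$, $[n]_\phi!=[1]_\phi\cdots[n]_\phi$, $[0]_\phi!=1$; for $F\in A[[t]]$, $D_\phi F(t)=\dfrac{F(\phi t)-F(t)}{(\phi-1)t}$. For $F\in A[[t]]$ with $F(0)=0$: $F^{[0]_\phi}=1$ and for $k\ge1$, $F^{[k]_\phi}$ is the unique series with zero constant term such that $D_\phi F^{[k]_\phi}=[k]_\phi F^{[k-1]_\phi}D_\phi F$; similarly $F^{[0]^*_\phi}=1$ and for $k\ge1$, $F^{[k]^*_\phi}$ is the unique series with zero constant term such that $D_\phi F^{[k]^*_\phi}(t)=[k]_\phi\,\phi^{ -(k-1)}F^{[k-1]^*_\phi}(\phi t)\,D_\phi F(t)$. For $G(t)=\sum_{k\ge0}a_kt^k\in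 A[[t]]$, define $G[F]_\phi=\sum_{k\ge0}a_kF^{[k]_\phi}$ and $G[F]^*_\phi=\sum_{k\ge0}a_kF^{[k]^*_\phi}$ (these sums converge formally). $\mathbf{e}_\phi(t)=\sum_{n\ge0}t^n/[n]_\phi!$ and $\mathbf{E}_\phi(t)=\sum_{n\ge0}\phi^{\binom n2}t^n/[n]_\phi!$. -}

module Defs where

open import Level using (_⊔_)
open import Data.Nat as ℕ using (ℕ; zero; suc; _∸_)
open import Data.Nat.Combinatorics using (_C_)
open import Data.Integer as ℤ using (ℤ; +_; -[1+_])
open import Data.Rational as ℚ using (ℚ; 0ℚ; 1ℚ)
open import Data.Product using (_×_; _,_)
open import Relation.Binary.PropositionalEquality using (_≡_)
open import Algebra.Bundles using (CommutativeRing)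

-- The field ℚ((q)) of formal Laurent series over ℚ.
-- A pair (N , c) represents  Σ_{k ≥ 0} c k · q^(N + k).
-- Equality is equality of all ℤ-indexed coefficients (a setoid).

Laurent : Set
Laurent = ℤ × (ℕ → ℚ)

coeffL : Laurent → ℤ → ℚ
coeffL (N , c) n with n ℤ.- N
... | + k      = c k
... | -[1+ _ ] = 0ℚ

_≈L_ : Laurent → Laurent → Set
x ≈L y = ∀ n → coeffL x n ≡ coeffL y n

sumℚ : ℕ → (ℕ → ℚ) → ℚ
sumℚ zero    f = 0ℚ
sumℚ (suc n) f = sumℚ n f ℚ.+ f n

δℚ : ℕ → ℚ
δℚ zero    = 1ℚ
δℚ (suc _) = 0ℚ

_+L_ : Laurent → Laurent → Laurent
x@(N , _) +L y@(M , _) =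
  (N ℤ.⊓ M , λ k → coeffL x ((N ℤ.⊓ M) ℤ.+ + k) ℚ.+ coeffL y ((N ℤ.⊓ M) ℤ.+ + k))

_*L_ : Laurent → Laurent → Laurent
(N , c) *L (M , d) = (N ℤ.+ M , λ k → sumℚ (suc k) (λ i → c i ℚ.* d (k ∸ i)))

1L : Laurent
1L = (+ 0 , δℚ)

qpow : ℤ → Laurent
qpow m = (m , δℚ)

-- A commutative algebra over ℚ((q)): a commutative ring R together with
-- a (unital) ring homomorphism ι : ℚ((q)) → R (the structure map).

record IsLaurentAlgebra {c ℓ} (R : CommutativeRing c ℓ)
                        (ι : Laurent → CommutativeRing.Carrier R) : Set (c ⊔ ℓ) where
  open CommutativeRing R
  field
    ι-cong : ∀ {x y} → x ≈L y → ι x ≈ ι y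
    ι-+    : ∀ x y → ι (x +L y) ≈ ι x + ι y
    ι-*    : ∀ x y → ι (x *L y) ≈ ι x * ι y
    ι-1    : ι 1L ≈ 1#

module Series {c ℓ} (R : CommutativeRing c ℓ) where
  open CommutativeRing R

  PS : Set c
  PS = ℕ → Carrier

  _≈ₚ_ : PS → PS → Set ℓ
  F ≈ₚ G = ∀ n → F n ≈ G n

  pow : Carrier → ℕ → Carrier
  pow x zero    = 1#
  pow x (suc n) = x * pow x n

  sumR : ℕ → (ℕ → Carrier) → Carrier
  sumR zero    f = 0#
  sumR (suc n) f = sumR n f + f n

  _⋆_ : PS → PS → PS
  (F ⋆ G) n = sumR (suc n) (λ i → F i * G (n ∸ i))

  oneₚ : PS
  oneₚ zero    = 1#
  oneₚ (suc _) = 0#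

  _·ₚ_ : Carrier → PS → PS
  (a ·ₚ F) n = a * F n

  dil : Carrier → PS → PS
  dil φ F n = pow φ n * F n

  qint : Carrier → ℕ → Carrier
  qint φ zero    = 0#
  qint φ (suc n) = 1# + φ * qint φ n

  qfact : Carrier → ℕ → Carrier
  qfact φ zero    = 1#
  qfact φ (suc n) = qfact φ n * qint φ (suc n)

  -- D_φ F(t) = (F(φt) - F(t)) / ((φ - 1) t); its t^n-coefficient is
  -- (φ^(n+1) - 1)/(φ - 1) · F_(n+1) = [n+1]_φ · F_(n+1).
  Dq : Carrier → PS → PS
  Dq φ F n = qint φ (suc n) * F (suc n)

  record IsQPowers (φ : Carrier) (F : PS) (S : ℕ → PS) : Set (c ⊔ ℓ) where
    field
      pow-zero : S 0 ≈ₚ oneₚ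
      const-0  : ∀ k → S (suc k) 0 ≈ 0#
      deriv    : ∀ k → Dq φ (S (suc k)) ≈ₚ (qint φ (suc k) ·ₚ (S k ⋆ Dq φ F))

  -- S k = F^{[k]*_φ}, where φinv is φ^{-1}
  record IsQPowersStar (φ φinv : Carrier) (F : PS) (S : ℕ → PS) : Set (c ⊔ ℓ) where
    field
      pow-zero : S 0 ≈ₚ oneₚ
      const-0  : ∀ k → S (suc k) 0 ≈ 0#
      deriv    : ∀ k → Dq φ (S (suc k))
                       ≈ₚ ((qint φ (suc k) * pow φinv k) ·ₚ (dil φ (S k) ⋆ Dq φ F))

  -- G[F] = Σ_k G_k F^{[k]} ; since F^{[k]} has order ≥ k, the t^n
  -- coefficient of this formally convergent sum is Σ_{k ≤ n} G_k (F^{[k]})_n.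
  subst : PS → (ℕ → PS) → PS
  subst G S n = sumR (suc n) (λ k → G k * S k n)

  IsECoeffs : Carrier → PS → Set ℓ
  IsECoeffs φ a = ∀ n → a n * qfact φ n ≈ pow φ (n C 2)

  IsExpCoeffs : Carrier → PS → Set ℓ
  IsExpCoeffs φ a = ∀ n → a n * qfact φ n ≈ 1#

-- Write p = ψ and x = ψ⁻¹ = q^(-m), so p x = 1. Multiplying [n+1]_x = 1 + x + … + x^n by p^n
-- reverses it into [n+1]_p, i.e. [n+1]_p = p^n [n+1]_x, and hence [k]_p! = p^(k choose 2) [k]_x!.
-- In the t^n coefficient of the defining equation of F^{[k+1]*_p}, the dilation weights p^i and
-- the factors p^(n-i) coming from D_p F combine to p^n, so the equation becomes p^n times the
-- defining equation of F^{[k+1]_x}. Since p^n and [n+1]_x are units in A (the latter because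
-- 1 - q^N, N ≠ 0, is invertible in ℚ((q))), the two families of powers satisfy the same recursion
-- and agree; (ii) follows coefficientwise, and (iii) because the coefficients of E_p and e_x agree.
module Submission where

open import Level using (_⊔_)
open import Data.Nat as ℕ using (ℕ; zero; suc; _∸_; _<_; s≤s)
import Data.Nat.Properties as ℕₚ
open import Data.Nat.DivMod using (_%_; m≤n⇒m%n≡m; m≤n⇒[n∸m]%m≡n%m)
open import Data.Nat.Combinatorics using (_C_; nC1≡n; nCk+nC[k+1]≡[n+1]C[k+1])
open import Data.Integer as ℤ using (ℤ; +_; -[1+_]; _⊖_)
import Data.Integer.Properties as ℤₚ
open import Data.Rational as ℚ using (ℚ; 0ℚ)
import Data.Rational.Properties as ℚₚ
open import Data.Product using (_×_; _,_)
open import Data.Sum using (inj₁; inj₂)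
open import Data.Empty using (⊥-elim)
open import Relation.Binary.PropositionalEquality as ≡ using (_≡_; _≢_)
open import Algebra.Bundles using (CommutativeRing)
open import Defs

coeffFrom : (ℕ → ℚ) → ℤ → ℚ
coeffFrom c (+ k)    = c k
coeffFrom c -[1+ _ ] = 0ℚ

coeffL≡coeffFrom : ∀ N c n → coeffL (N , c) n ≡ coeffFrom c (n ℤ.- N)
coeffL≡coeffFrom N c n with n ℤ.- N
... | + k      = ≡.refl
... | -[1+ _ ] = ≡.refl

coeffFrom-cong : ∀ {c d} → (∀ k → c k ≡ d k) → ∀ n → coeffFrom c n ≡ coeffFrom d n
coeffFrom-cong c≗d (+ k)    = c≗d k
coeffFrom-cong c≗d -[1+ _ ] = ≡.refl

≈L-reflexive : ∀ {x y} → x ≡ y → x ≈L y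
≈L-reflexive ≡.refl _ = ≡.refl

offset-cong : ∀ N {c d} → (∀ k → c k ≡ d k) → (N , c) ≈L (N , d)
offset-cong N {c} {d} c≗d n = ≡.trans (coeffL≡coeffFrom N c n)
  (≡.trans (coeffFrom-cong c≗d (n ℤ.- N)) (≡.sym (coeffL≡coeffFrom N d n)))

sumℚ-δℚ : ∀ n (h : ℕ → ℚ) → sumℚ (suc n) (λ i → δℚ i ℚ.* h i) ≡ h 0
sumℚ-δℚ zero    h = ≡.trans (ℚₚ.+-identityˡ _) (ℚₚ.*-identityˡ _)
sumℚ-δℚ (suc n) h =
  ≡.trans (≡.cong₂ ℚ._+_ (sumℚ-δℚ n h) (ℚₚ.*-zeroˡ (h (suc n)))) (ℚₚ.+-identityʳ _)

qpow-*L : ∀ a M c → (qpow a *L (M , c)) ≈L (a ℤ.+ M , c)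
qpow-*L a M c = offset-cong (a ℤ.+ M) (λ k → sumℚ-δℚ k (λ i → c (k ∸ i)))

qpow-+ : ∀ a b → (qpow a *L qpow b) ≈L qpow (a ℤ.+ b)
qpow-+ a b = qpow-*L a b δℚ

-- the coefficients of Σ_j q^((b+1) j)
geometricCoeff : ℕ → ℕ → ℚ
geometricCoeff b k = δℚ (k % suc b)

geometric : ℕ → Laurent
geometric b = (+ 0 , geometricCoeff b)

geometricCoeff-step : ∀ b k →
  geometricCoeff b k ≡ δℚ k ℚ.+ coeffFrom (geometricCoeff b) (k ⊖ suc b)
geometricCoeff-step b k with ℕₚ.<-≤-connex k (suc b)
... | inj₁ k<N = begin
  δℚ (k % suc b)                                  ≡⟨ ≡.cong δℚ (m≤n⇒m%n≡m (ℕₚ.≤-pred k<N)) ⟩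
  δℚ k                                            ≡⟨ ℚₚ.+-identityʳ (δℚ k) ⟨
  δℚ k ℚ.+ 0ℚ                                     ≡⟨ ≡.cong (δℚ k ℚ.+_) (below k<N) ⟨
  δℚ k ℚ.+ coeffFrom γ (ℤ.- + (suc b ∸ k))        ≡⟨ ≡.cong (λ z → δℚ k ℚ.+ coeffFrom γ z) (ℤₚ.⊖-< k<N) ⟨
  δℚ k ℚ.+ coeffFrom γ (k ⊖ suc b)                ∎
  where
  open ≡.≡-Reasoning
  γ = geometricCoeff b
  below : ∀ {k N} → k < N → coeffFrom γ (ℤ.- + (N ∸ k)) ≡ 0ℚ
  below {zero}  {suc N} _       = ≡.refl
  below {suc k} {suc N} (s≤s p) = below p
... | inj₂ N≤k@(s≤s _) = begin
  δℚ (k % suc b)                                  ≡⟨ ≡.cong δℚ (m≤n⇒[n∸m]%m≡n%m N≤k) ⟨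
  δℚ ((k ∸ suc b) % suc b)                        ≡⟨ ℚₚ.+-identityˡ _ ⟨
  0ℚ ℚ.+ coeffFrom γ (+ (k ∸ suc b))              ≡⟨ ≡.cong (λ z → 0ℚ ℚ.+ coeffFrom γ z) (ℤₚ.⊖-≥ N≤k) ⟨
  δℚ k ℚ.+ coeffFrom γ (k ⊖ suc b)                ∎
  where
  open ≡.≡-Reasoning
  γ = geometricCoeff b

geometric-fixpoint : ∀ b → geometric b ≈L (1L +L (qpow (+ suc b) *L geometric b))
geometric-fixpoint b = offset-cong (+ 0) λ k → begin
  γ k                                                              ≡⟨ geometricCoeff-step b k ⟩
  δℚ k ℚ.+ coeffFrom γ (k ⊖ suc b)                                 ≡⟨ ≡.cong₂ ℚ._+_ (one k) (shifted k) ⟨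
  coeffL 1L (+ k) ℚ.+ coeffL (qpow (+ suc b) *L geometric b) (+ k) ∎
  where
  open ≡.≡-Reasoning
  γ = geometricCoeff b
  one : ∀ k → coeffL 1L (+ k) ≡ δℚ k
  one k = ≡.trans (coeffL≡coeffFrom (+ 0) δℚ (+ k)) (≡.cong (coeffFrom δℚ) (ℤₚ.+-identityʳ (+ k)))
  shifted : ∀ k → coeffL (qpow (+ suc b) *L geometric b) (+ k) ≡ coeffFrom γ (k ⊖ suc b)
  shifted k = begin
    coeffL (qpow (+ suc b) *L geometric b) (+ k)  ≡⟨ qpow-*L (+ suc b) (+ 0) γ (+ k) ⟩
    coeffL (+ suc b ℤ.+ + 0 , γ) (+ k)            ≡⟨ coeffL≡coeffFrom (+ suc b ℤ.+ + 0) γ (+ k) ⟩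
    coeffFrom γ (+ k ℤ.- (+ suc b ℤ.+ + 0))       ≡⟨ ≡.cong (λ z → coeffFrom γ (+ k ℤ.- z)) (ℤₚ.+-identityʳ (+ suc b)) ⟩
    coeffFrom γ (+ k ℤ.- + suc b)                 ≡⟨ ≡.cong (coeffFrom γ) (ℤₚ.m-n≡m⊖n k (suc b)) ⟩
    coeffFrom γ (k ⊖ suc b)                       ∎

module RingLemmas {c ℓ} (R : CommutativeRing c ℓ) where
  open CommutativeRing R
  open Series R
  open import Algebra.Definitions _≈_ using (RightInvertible)
  open import Algebra.Properties.Ring ring using (-‿distribˡ-*; -‿distribʳ-*)
  open import Algebra.Solver.Ring.NaturalCoefficients.Default commutativeSemiring
  open import Relation.Binary.Reasoning.Setoid setoid

  IsUnit : Carrier → Set (c ⊔ ℓ)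
  IsUnit = RightInvertible 1# _*_

  isUnit-resp : ∀ {u v} → u ≈ v → IsUnit v → IsUnit u
  isUnit-resp u≈v (w , vw≈1) = w , trans (*-congʳ u≈v) vw≈1

  isUnit-* : ∀ {u v} → IsUnit u → IsUnit v → IsUnit (u * v)
  isUnit-* {u} {v} (u' , uu'≈1) (v' , vv'≈1) = u' * v' , (begin
    (u * v) * (u' * v')  ≈⟨ solve 4 (λ u v u' v' → (u :* v) :* (u' :* v') := (u :* u') :* (v :* v')) refl u v u' v' ⟩
    (u * u') * (v * v')  ≈⟨ *-cong uu'≈1 vv'≈1 ⟩
    1# * 1#              ≈⟨ *-identityˡ 1# ⟩
    1#                   ∎)

  isUnit-*ˡ : ∀ {u v} → IsUnit (u * v) → IsUnit u
  isUnit-*ˡ {u} {v} (w , uvw≈1) = v * w , trans (sym (*-assoc u v w)) uvw≈1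

  isUnit-*-cancelˡ : ∀ {u a b} → IsUnit u → u * a ≈ u * b → a ≈ b
  isUnit-*-cancelˡ {u} {a} {b} (v , uv≈1) ua≈ub = begin
    a              ≈⟨ undo a ⟨
    v * (u * a)    ≈⟨ *-congˡ ua≈ub ⟩
    v * (u * b)    ≈⟨ undo b ⟩
    b              ∎
    where
    undo : ∀ a → v * (u * a) ≈ a
    undo a = begin
      v * (u * a)  ≈⟨ solve 3 (λ u v a → v :* (u :* a) := (u :* v) :* a) refl u v a ⟩
      (u * v) * a  ≈⟨ *-congʳ uv≈1 ⟩
      1# * a       ≈⟨ *-identityˡ a ⟩
      a            ∎

  geometric-inverse : ∀ {y g} → g ≈ 1# + y * g → (1# - y) * g ≈ 1#
  geometric-inverse {y} {g} g≈1+yg = begin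
    (1# + - y) * g              ≈⟨ solve 2 (λ m g → (con 1 :+ m) :* g := g :+ m :* g) refl (- y) g ⟩
    g + (- y) * g               ≈⟨ +-cong g≈1+yg (sym (-‿distribˡ-* y g)) ⟩
    (1# + y * g) + - (y * g)    ≈⟨ +-assoc 1# (y * g) (- (y * g)) ⟩
    1# + (y * g + - (y * g))    ≈⟨ +-congˡ (-‿inverseʳ (y * g)) ⟩
    1# + 0#                     ≈⟨ +-identityʳ 1# ⟩
    1#                          ∎

  pow-+ : ∀ φ i j → pow φ (i ℕ.+ j) ≈ pow φ i * pow φ j
  pow-+ φ zero    j = sym (*-identityˡ _)
  pow-+ φ (suc i) j = trans (*-congˡ (pow-+ φ i j)) (sym (*-assoc _ _ _))

  pow-*-inverse : ∀ {p x} → p * x ≈ 1# → ∀ n → pow p n * pow x n ≈ 1#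
  pow-*-inverse px≈1 zero    = *-identityˡ 1#
  pow-*-inverse {p} {x} px≈1 (suc n) = begin
    (p * pow p n) * (x * pow x n)  ≈⟨ solve 4 (λ p P x X → (p :* P) :* (x :* X) := (p :* x) :* (P :* X)) refl p (pow p n) x (pow x n) ⟩
    (p * x) * (pow p n * pow x n)  ≈⟨ *-cong px≈1 (pow-*-inverse px≈1 n) ⟩
    1# * 1#                        ≈⟨ *-identityˡ 1# ⟩
    1#                             ∎

  qint-suc : ∀ φ n → qint φ (suc n) ≈ qint φ n + pow φ n
  qint-suc φ zero = begin
    1# + φ * 0#  ≈⟨ +-congˡ (zeroʳ φ) ⟩
    1# + 0#      ≈⟨ +-comm 1# 0# ⟩
    0# + 1#      ∎
  qint-suc φ (suc n) = begin
    1# + φ * qint φ (suc n)          ≈⟨ +-congˡ (*-congˡ (qint-suc φ n)) ⟩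
    1# + φ * (qint φ n + pow φ n)    ≈⟨ solve 3 (λ φ q p → con 1 :+ φ :* (q :+ p) := (con 1 :+ φ :* q) :+ φ :* p) refl φ (qint φ n) (pow φ n) ⟩
    (1# + φ * qint φ n) + φ * pow φ n ∎

  qint-*-1-φ : ∀ φ n → qint φ n * (1# - φ) ≈ 1# - pow φ n
  qint-*-1-φ φ zero = begin
    0# * (1# + - φ)  ≈⟨ zeroˡ _ ⟩
    0#               ≈⟨ -‿inverseʳ 1# ⟨
    1# + - 1#        ∎
  qint-*-1-φ φ (suc n) = begin
    (1# + φ * q) * (1# + - φ)           ≈⟨ solve 3 (λ φ q m → (con 1 :+ φ :* q) :* (con 1 :+ m) := (con 1 :+ m) :+ φ :* (q :* (con 1 :+ m))) refl φ q (- φ) ⟩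
    (1# + - φ) + φ * (q * (1# + - φ))   ≈⟨ +-congˡ (*-congˡ (qint-*-1-φ φ n)) ⟩
    (1# + - φ) + φ * (1# + - P)         ≈⟨ solve 4 (λ φ m P r → (con 1 :+ m) :+ φ :* (con 1 :+ r) := con 1 :+ ((m :+ φ) :+ φ :* r)) refl φ (- φ) P (- P) ⟩
    1# + ((- φ + φ) + φ * - P)          ≈⟨ +-congˡ (+-congʳ (-‿inverseˡ φ)) ⟩
    1# + (0# + φ * - P)                 ≈⟨ +-congˡ (+-identityˡ _) ⟩
    1# + φ * - P                        ≈⟨ +-congˡ (-‿distribʳ-* φ P) ⟨
    1# + - (φ * P)                      ∎
    where
    q = qint φ n
    P = pow φ n

  sumR-cong : ∀ n {f g} → (∀ i → i < n → f i ≈ g i) → sumR n f ≈ sumR n g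
  sumR-cong zero    f≈g = refl
  sumR-cong (suc n) f≈g = +-cong (sumR-cong n (λ i i<n → f≈g i (ℕₚ.m<n⇒m<1+n i<n))) (f≈g n ℕₚ.≤-refl)

  *-distribˡ-sumR : ∀ a n f → a * sumR n f ≈ sumR n (λ i → a * f i)
  *-distribˡ-sumR a zero    f = zeroʳ a
  *-distribˡ-sumR a (suc n) f = trans (distribˡ a _ _) (+-congʳ (*-distribˡ-sumR a n f))

  module Reciprocal {p x : Carrier} (px≈1 : p * x ≈ 1#) where

    isUnit-pow : ∀ n → IsUnit (pow p n)
    isUnit-pow n = pow x n , pow-*-inverse px≈1 n

    qint-reciprocal : ∀ n → qint p (suc n) ≈ pow p n * qint x (suc n)
    qint-reciprocal zero =
      solve 2 (λ p x → con 1 :+ p :* con 0 := con 1 :* (con 1 :+ x :* con 0)) refl p x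
    qint-reciprocal (suc n) = begin
      qint p (suc (suc n))          ≈⟨ qint-suc p (suc n) ⟩
      qint p (suc n) + p * P        ≈⟨ +-congʳ (qint-reciprocal n) ⟩
      P * Q + p * P                 ≈⟨ solve 3 (λ p P Q → P :* Q :+ p :* P := p :* P :+ P :* (con 1 :* Q)) refl p P Q ⟩
      p * P + P * (1# * Q)          ≈⟨ +-congˡ (*-congˡ (*-congʳ px≈1)) ⟨
      p * P + P * ((p * x) * Q)     ≈⟨ solve 4 (λ p P x Q → (p :* P) :* (con 1 :+ x :* Q) := (p :* P) :+ P :* ((p :* x) :* Q)) refl p P x Q ⟨
      (p * P) * (1# + x * Q)        ∎
      where
      P = pow p n
      Q = qint x (suc n)

    qint-reciprocal-* : ∀ k → qint p (suc k) * pow x k ≈ qint x (suc k)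
    qint-reciprocal-* k = begin
      qint p (suc k) * pow x k          ≈⟨ *-congʳ (qint-reciprocal k) ⟩
      (pow p k * Q) * pow x k           ≈⟨ solve 3 (λ P Q X → (P :* Q) :* X := (P :* X) :* Q) refl (pow p k) Q (pow x k) ⟩
      (pow p k * pow x k) * Q           ≈⟨ *-congʳ (pow-*-inverse px≈1 k) ⟩
      1# * Q                            ≈⟨ *-identityˡ Q ⟩
      Q                                 ∎
      where Q = qint x (suc k)

    qfact-reciprocal : ∀ k → qfact p k ≈ pow p (k C 2) * qfact x k
    qfact-reciprocal zero    = sym (*-identityˡ 1#)
    qfact-reciprocal (suc k) = begin
      qfact p k * qint p (suc k)
        ≈⟨ *-cong (qfact-reciprocal k) (qint-reciprocal k) ⟩
      (pow p (k C 2) * qfact x k) * (pow p k * qint x (suc k))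
        ≈⟨ solve 4 (λ a b d e → (a :* b) :* (d :* e) := (d :* a) :* (b :* e)) refl (pow p (k C 2)) (qfact x k) (pow p k) (qint x (suc k)) ⟩
      (pow p k * pow p (k C 2)) * (qfact x k * qint x (suc k))
        ≈⟨ *-congʳ (trans (sym (pow-+ p k (k C 2))) (reflexive (≡.cong (pow p) k+kC2≡[k+1]C2))) ⟩
      pow p (suc k C 2) * (qfact x k * qint x (suc k)) ∎
      where
      k+kC2≡[k+1]C2 : k ℕ.+ k C 2 ≡ suc k C 2
      k+kC2≡[k+1]C2 = ≡.trans (≡.cong (ℕ._+ k C 2) (≡.sym (nC1≡n k))) (nCk+nC[k+1]≡[n+1]C[k+1] k 1)

  module Uniqueness {p x : Carrier} (px≈1 : p * x ≈ 1#)
                    (isUnit-qint : ∀ n → IsUnit (qint x (suc n)))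
                    {F : PS} {S* S : ℕ → PS}
                    (isS* : IsQPowersStar p x F S*) (isS : IsQPowers x F S) where
    open Reciprocal px≈1
    module S* = IsQPowersStar isS*
    module S = IsQPowers isS

    starPowers≈powers : ∀ k → S* k ≈ₚ S k
    starPowers≈powers zero    n       = trans (S*.pow-zero n) (sym (S.pow-zero n))
    starPowers≈powers (suc k) zero    = trans (S*.const-0 k) (sym (S.const-0 k))
    starPowers≈powers (suc k) (suc n) =
      isUnit-*-cancelˡ (isUnit-qint n) (isUnit-*-cancelˡ (isUnit-pow n) scaled)
      where
      Pn = pow p n
      Qn = qint x (suc n)
      g : ℕ → Carrier
      g i = S k i * Dq x F (n ∸ i)
      term : ∀ i → i < suc n → (pow p i * S* k i) * Dq p F (n ∸ i) ≈ Pn * g i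
      term i i<1+n = begin
        (pow p i * S* k i) * (qint p (suc (n ∸ i)) * F (suc (n ∸ i)))
          ≈⟨ *-cong (*-congˡ (starPowers≈powers k i)) (*-congʳ (qint-reciprocal (n ∸ i))) ⟩
        (pow p i * S k i) * ((pow p (n ∸ i) * qint x (suc (n ∸ i))) * F (suc (n ∸ i)))
          ≈⟨ solve 5 (λ a s b q f → (a :* s) :* ((b :* q) :* f) := (a :* b) :* (s :* (q :* f))) refl
               (pow p i) (S k i) (pow p (n ∸ i)) (qint x (suc (n ∸ i))) (F (suc (n ∸ i))) ⟩
        (pow p i * pow p (n ∸ i)) * g i
          ≈⟨ *-congʳ (trans (sym (pow-+ p i (n ∸ i))) (reflexive (≡.cong (pow p) (ℕₚ.m+[n∸m]≡n (ℕₚ.≤-pred i<1+n))))) ⟩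
        Pn * g i ∎
      scaled : Pn * (Qn * S* (suc k) (suc n)) ≈ Pn * (Qn * S (suc k) (suc n))
      scaled = begin
        Pn * (Qn * S* (suc k) (suc n))        ≈⟨ *-assoc Pn Qn _ ⟨
        (Pn * Qn) * S* (suc k) (suc n)        ≈⟨ *-congʳ (qint-reciprocal n) ⟨
        qint p (suc n) * S* (suc k) (suc n)   ≈⟨ S*.deriv k n ⟩
        (qint p (suc k) * pow x k) * sumR (suc n) (λ i → (pow p i * S* k i) * Dq p F (n ∸ i))
          ≈⟨ *-cong (qint-reciprocal-* k) (trans (sumR-cong (suc n) term) (sym (*-distribˡ-sumR Pn (suc n) g))) ⟩
        qint x (suc k) * (Pn * sumR (suc n) g)
          ≈⟨ solve 3 (λ a b d → a :* (b :* d) := b :* (a :* d)) refl (qint x (suc k)) Pn (sumR (suc n) g) ⟩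
        Pn * (qint x (suc k) * sumR (suc n) g) ≈⟨ *-congˡ (S.deriv k n) ⟨
        Pn * (Qn * S (suc k) (suc n))         ∎

    subst-starPowers≈subst-powers : ∀ G → subst G S* ≈ₚ subst G S
    subst-starPowers≈subst-powers G n = sumR-cong (suc n) (λ k _ → *-congˡ (starPowers≈powers k n))

    isUnit-qfact : ∀ k → IsUnit (qfact x k)
    isUnit-qfact zero    = 1# , *-identityˡ 1#
    isUnit-qfact (suc k) = isUnit-* (isUnit-qfact k) (isUnit-qint k)

    ECoeffs≈ExpCoeffs : ∀ {a b} → IsECoeffs p a → IsExpCoeffs x b → a ≈ₚ b
    ECoeffs≈ExpCoeffs {a} {b} isE isExp k =
      isUnit-*-cancelˡ (isUnit-qfact k) (trans (*-comm _ _) (trans a[k]![k]≈1 (sym (trans (*-comm _ _) (isExp k)))))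
      where
      e = k C 2
      a[k]![k]≈1 : a k * qfact x k ≈ 1#
      a[k]![k]≈1 = isUnit-*-cancelˡ (isUnit-pow e) (begin
        pow p e * (a k * qfact x k)  ≈⟨ solve 3 (λ a P f → P :* (a :* f) := a :* (P :* f)) refl (a k) (pow p e) (qfact x k) ⟩
        a k * (pow p e * qfact x k)  ≈⟨ *-congˡ (qfact-reciprocal k) ⟨
        a k * qfact p k              ≈⟨ isE k ⟩
        pow p e                      ≈⟨ *-identityʳ _ ⟨
        pow p e * 1#                 ∎)

    subst-E≈subst-exp : ∀ {a b} → IsECoeffs p a → IsExpCoeffs x b → subst a S* ≈ₚ subst b S
    subst-E≈subst-exp isE isExp n =
      sumR-cong (suc n) (λ k _ → *-cong (ECoeffs≈ExpCoeffs isE isExp k) (starPowers≈powers k n))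

module LaurentAlgebra {c ℓ} {R : CommutativeRing c ℓ} {ι : Laurent → CommutativeRing.Carrier R}
                      (isLA : IsLaurentAlgebra R ι) where
  open CommutativeRing R
  open Series R
  open RingLemmas R
  open IsLaurentAlgebra isLA

  ι-qpow-+ : ∀ a b → ι (qpow a) * ι (qpow b) ≈ ι (qpow (a ℤ.+ b))
  ι-qpow-+ a b = trans (sym (ι-* _ _)) (ι-cong (qpow-+ a b))

  ι-qpow-inverse : ∀ m → ι (qpow m) * ι (qpow (ℤ.- m)) ≈ 1#
  ι-qpow-inverse m = trans (ι-qpow-+ m (ℤ.- m)) (trans (ι-cong (≈L-reflexive (≡.cong qpow (ℤₚ.+-inverseʳ m)))) ι-1)

  pow-ι-qpow : ∀ a n → pow (ι (qpow (+ a))) n ≈ ι (qpow (+ (n ℕ.* a)))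
  pow-ι-qpow a zero    = sym ι-1
  pow-ι-qpow a (suc n) = trans (*-congˡ (pow-ι-qpow a n)) (ι-qpow-+ (+ a) (+ (n ℕ.* a)))

  isUnit-1-ι-qpow : ∀ b → IsUnit (1# - ι (qpow (+ suc b)))
  isUnit-1-ι-qpow b = ι (geometric b) , geometric-inverse
    (trans (ι-cong (geometric-fixpoint b)) (trans (ι-+ _ _) (+-cong ι-1 (ι-* _ _))))

  isUnit-qint-ι-qpow-pos : ∀ b n → IsUnit (qint (ι (qpow (+ suc b))) (suc n))
  isUnit-qint-ι-qpow-pos b n = isUnit-*ˡ (isUnit-resp
    (trans (qint-*-1-φ y (suc n)) (+-congˡ (-‿cong (pow-ι-qpow (suc b) (suc n)))))
    (isUnit-1-ι-qpow (b ℕ.+ n ℕ.* suc b)))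
    where y = ι (qpow (+ suc b))

  isUnit-qint-ι-qpow : ∀ m → m ≢ + 0 → ∀ n → IsUnit (qint (ι (qpow m)) (suc n))
  isUnit-qint-ι-qpow (+ zero)   m≢0 n = ⊥-elim (m≢0 ≡.refl)
  isUnit-qint-ι-qpow (+ suc b)  m≢0 n = isUnit-qint-ι-qpow-pos b n
  isUnit-qint-ι-qpow -[1+ b ]   m≢0 n = isUnit-resp (qint-reciprocal n)
    (isUnit-* (isUnit-pow n) (isUnit-qint-ι-qpow-pos b n))
    where open Reciprocal (ι-qpow-inverse -[1+ b ])

open import Data.Integer using (-_)

theorem7p1 : ∀ {c ℓ} (R : CommutativeRing c ℓ)
    (ι : Laurent → CommutativeRing.Carrier R) → IsLaurentAlgebra R ι →
    (m : ℤ) → m ≢ + 0 →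
    let ψ = ι (qpow m)
        ψinv = ι (qpow (- m))
        open CommutativeRing R
        open Series R
    in (F : PS) → F 0 ≈ 0# →
       (Sstar : ℕ → PS) → IsQPowersStar ψ ψinv F Sstar →
       (S : ℕ → PS) → IsQPowers ψinv F S →
       ((k : ℕ) → Sstar k ≈ₚ S k)
       × ((G : PS) → subst G Sstar ≈ₚ subst G S)
       × ((a b : PS) → IsECoeffs ψ a → IsExpCoeffs ψinv b →
            subst a Sstar ≈ₚ subst b S)
theorem7p1 R ι isLA m m≢0 F _ Sstar isS* S isS =
  starPowers≈powers , subst-starPowers≈subst-powers , λ _ _ → subst-E≈subst-exp
  where
  open LaurentAlgebra isLA
  -m≢0 : - m ≢ + 0
  -m≢0 -m≡0 = m≢0 (ℤₚ.neg-injective -m≡0)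
  open RingLemmas.Uniqueness R (ι-qpow-inverse m) (isUnit-qint-ι-qpow (- m) -m≢0) isS* isS
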